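{- There is no maximal dark ceer, i.e., there is no dark ceer $E$ such that every dark ceer $R$ with $E\leq R$ satisfies $R\leq E$.
   Context: A ceer is a computably enumerable equivalence relation on $\omega$. For equivalence relations $E,R$ on $\omega$, $E\leq R$ means there is a computable $f$ with $x\mathrel{E}y\iff f(x)\mathrel{R}f(y)$ for all $x,y$. $\mathrm{Id}$ is equality on $\omega$. A ceer $R$ is dark if it has infinitely many classes and $\mathrm{Id}\not\leq R$. -}

module Defs where

open import Data.Nat using (ℕ; zero; suc; _<_)
open import Data.Fin using (Fin)
open import Data.Vec using (Vec; []; _∷_; lookup)
open import Data.Product using (Σ; ∃; _×_; _,_)
open import Data.List using (List)
open import Data.List.Relation.Unary.Any using (Any)
open import Relation.Nullary using (¬_)
open import Relation.Binary.PropositionalEquality using (_≡_)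
open import Relation.Binary.Structures using (IsEquivalence)
open import Function.Bundles using (_⇔_)

data PR : ℕ → Set where
  zer  : ∀ {n} → PR n
  succ : PR 1
  proj : ∀ {n} → Fin n → PR n
  comp : ∀ {m n} → PR m → Vec (PR n) m → PR n
  prec : ∀ {n} → PR n → PR (suc (suc n)) → PR (suc n)
  mu   : ∀ {n} → PR (suc n) → PR n

mutual
  data Eval : ∀ {n} → PR n → Vec ℕ n → ℕ → Set where
    ev-zer  : ∀ {n} {v : Vec ℕ n} → Eval zer v 0
    ev-succ : ∀ {x} → Eval succ (x ∷ []) (suc x)
    ev-proj : ∀ {n} {i : Fin n} {v} → Eval (proj i) v (lookup v i)
    ev-comp : ∀ {m n} {f : PR m} {gs : Vec (PR n) m} {v ws y} →
              EvalAll gs v ws → Eval f ws y → Eval (comp f gs) v y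
    ev-prec0 : ∀ {n} {f : PR n} {g v y} →
               Eval f v y → Eval (prec f g) (0 ∷ v) y
    ev-precS : ∀ {n} {f : PR n} {g v k r y} →
               Eval (prec f g) (k ∷ v) r → Eval g (k ∷ r ∷ v) y →
               Eval (prec f g) (suc k ∷ v) y
    ev-mu   : ∀ {n} {f : PR (suc n)} {v y} →
              Eval f (y ∷ v) 0 →
              (∀ z → z < y → Σ ℕ λ k → Eval f (z ∷ v) (suc k)) →
              Eval (mu f) v y

  data EvalAll : ∀ {m n} → Vec (PR n) m → Vec ℕ n → Vec ℕ m → Set where
    ev-[] : ∀ {n} {v : Vec ℕ n} → EvalAll [] v []
    ev-∷  : ∀ {m n} {g : PR n} {gs : Vec (PR n) m} {v y ys} →
            Eval g v y → EvalAll gs v ys → EvalAll (g ∷ gs) v (y ∷ ys)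

Computable : (ℕ → ℕ) → Set
Computable f = Σ (PR 1) λ c → ∀ x → Eval c (x ∷ []) (f x)

-- The binary relation c.e.-enumerated by a code c : PR 2, namely the
-- domain of the partial computable function c  (x W_c y iff c(x,y)↓).
Dom : PR 2 → ℕ → ℕ → Set
Dom c x y = ∃ λ z → Eval c (x ∷ y ∷ []) z

record Ceer : Set₁ where
  field
    code  : PR 2
    isEqv : IsEquivalence (Dom code)

  rel : ℕ → ℕ → Set
  rel = Dom code

open Ceer public

_≤ᵣ_ : (ℕ → ℕ → Set) → (ℕ → ℕ → Set) → Set
E ≤ᵣ R = Σ (ℕ → ℕ) λ f → Computable f × (∀ x y → E x y ⇔ R (f x) (f y))

Id : ℕ → ℕ → Set
Id = _≡_

FinitelyManyClasses : (ℕ → ℕ → Set) → Set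
FinitelyManyClasses E = Σ (List ℕ) λ xs → ∀ y → Any (λ x → E y x) xs

InfinitelyManyClasses : (ℕ → ℕ → Set) → Set
InfinitelyManyClasses E = ¬ FinitelyManyClasses E

Dark : Ceer → Set
Dark E = InfinitelyManyClasses (rel E) × ¬ (Id ≤ᵣ rel E)

-- Adding one new singleton class to a dark ceer E gives the ceer Id₁ ⊕ E, which lies
-- above E (via x ↦ x + 1) and is still dark: a reduction of Id to it meets the new
-- class at most once, so it can be corrected into a reduction of Id to E. If E were
-- maximal, Id₁ ⊕ E ≤ E via some g. Then the point 0 and the copy of E inside Id₁ ⊕ E
-- have E-inequivalent images, so g 0, g (1 + g 0), g (1 + g (1 + g 0)), … lie in
-- pairwise distinct E-classes and this computable sequence reduces Id to E,
-- contradicting darkness.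
module Submission where

open import Defs
open import Data.Empty using (⊥; ⊥-elim)
open import Data.Fin using () renaming (zero to fzero; suc to fsuc)
open import Data.List using (map)
open import Data.List.Relation.Unary.Any as Any using ()
open import Data.List.Relation.Unary.Any.Properties using (gmap)
open import Data.Nat using (ℕ; zero; suc; pred)
open import Data.Nat.GeneralisedArithmetic using (fold)
open import Data.Nat.Properties using (<-cmp; suc-injective; 0≢1+n)
open import Data.Product using (Σ; _×_; _,_; swap)
open import Data.Sum using (_⊎_; inj₁; inj₂)
open import Data.Unit using (⊤; tt)
open import Data.Vec using (Vec; []; _∷_)
open import Function using (_∘_; id)
open import Function.Bundles using (mk⇔; Equivalence)
open import Function.Properties.Equivalence using () renaming (refl to ⇔-refl)
open import Level using (0ℓ)
open import Relation.Binary.Core using (Rel) renaming (_⇔_ to _⇔₂_)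
open import Relation.Binary.Definitions using (Reflexive; tri<; tri≈; tri>)
open import Relation.Binary.PropositionalEquality using (_≡_; refl; sym; cong; subst; subst₂)
open import Relation.Binary.Structures using (IsEquivalence)
open import Relation.Nullary using (¬_)

open Equivalence using (to; from)

private
  variable
    n : ℕ
    P Q E E′ R R′ : Rel ℕ 0ℓ

mutual
  eval-deterministic : ∀ {c : PR n} {v y y′} → Eval c v y → Eval c v y′ → y ≡ y′
  eval-deterministic ev-zer ev-zer = refl
  eval-deterministic ev-succ ev-succ = refl
  eval-deterministic ev-proj ev-proj = refl
  eval-deterministic (ev-comp as f) (ev-comp as′ f′)
    with evalAll-deterministic as as′
  ... | refl = eval-deterministic f f′
  eval-deterministic (ev-prec0 e) (ev-prec0 e′) = eval-deterministic e e′
  eval-deterministic (ev-precS r g) (ev-precS r′ g′)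
    with eval-deterministic r r′
  ... | refl = eval-deterministic g g′
  eval-deterministic (ev-mu {y = y} e below) (ev-mu {y = y′} e′ below′) with <-cmp y y′
  ... | tri< y<y′ _ _ = let (_ , e″) = below′ y y<y′ in
                        ⊥-elim (0≢1+n (eval-deterministic e e″))
  ... | tri≈ _ y≡y′ _ = y≡y′
  ... | tri> _ _ y′<y = let (_ , e″) = below y′ y′<y in
                        ⊥-elim (0≢1+n (eval-deterministic e′ e″))

  evalAll-deterministic : ∀ {m} {gs : Vec (PR n) m} {v ws ws′} →
                          EvalAll gs v ws → EvalAll gs v ws′ → ws ≡ ws′
  evalAll-deterministic ev-[] ev-[] = refl
  evalAll-deterministic (ev-∷ e es) (ev-∷ e′ es′)
    with eval-deterministic e e′ | evalAll-deterministic es es′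
  ... | refl | refl = refl

Computable₂ : (ℕ → ℕ → ℕ) → Set
Computable₂ t = Σ (PR 2) λ c → ∀ x y → Eval c (x ∷ y ∷ []) (t x y)

numeral : ℕ → PR n
numeral zero    = zer
numeral (suc k) = comp succ (numeral k ∷ [])

eval-numeral : ∀ k {v : Vec ℕ n} → Eval (numeral k) v k
eval-numeral zero    = ev-zer
eval-numeral (suc k) = ev-comp (ev-∷ (eval-numeral k) ev-[]) ev-succ

computable-const : ∀ k → Computable (λ _ → k)
computable-const k = numeral k , λ _ → eval-numeral k

computable-suc : Computable suc
computable-suc = succ , λ _ → ev-succ

computable-pred : Computable pred
computable-pred = prec zer (proj fzero) , eval
  where
  eval : ∀ x → Eval (prec zer (proj fzero)) (x ∷ []) (pred x)
  eval zero    = ev-prec0 ev-zer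
  eval (suc x) = ev-precS (eval x) ev-proj

computable-∘ : ∀ {f g} → Computable f → Computable g → Computable (f ∘ g)
computable-∘ (fc , f-eval) (gc , g-eval) =
  comp fc (gc ∷ []) , λ x → ev-comp (ev-∷ (g-eval x) ev-[]) (f-eval _)

computable₂-∘ : ∀ {t f g} → Computable₂ t → Computable f → Computable g →
                Computable (λ x → t (f x) (g x))
computable₂-∘ (tc , t-eval) (fc , f-eval) (gc , g-eval) =
  comp tc (fc ∷ gc ∷ []) , λ x → ev-comp (ev-∷ (f-eval x) (ev-∷ (g-eval x) ev-[])) (t-eval _ _)

computable-fold : ∀ a {s} → Computable s → Computable (fold a s)
computable-fold a (sc , s-eval) = iteration , eval
  where
  iteration : PR 1
  iteration = prec (numeral a) (comp sc (proj (fsuc fzero) ∷ []))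

  eval : ∀ k → Eval iteration (k ∷ []) (fold a _ k)
  eval zero    = ev-prec0 (eval-numeral a)
  eval (suc k) = ev-precS (eval k) (ev-comp (ev-∷ ev-proj ev-[]) (s-eval _))

firstNonzero : ℕ → ℕ → ℕ
firstNonzero zero    y = y
firstNonzero (suc x) y = suc x

computable₂-firstNonzero : Computable₂ firstNonzero
computable₂-firstNonzero = cases , eval
  where
  cases : PR 2
  cases = prec (proj fzero) (comp succ (proj fzero ∷ []))

  eval : ∀ x y → Eval cases (x ∷ y ∷ []) (firstNonzero x y)
  eval zero    y = ev-prec0 ev-proj
  eval (suc x) y = ev-precS (eval x y) (ev-comp (ev-∷ ev-proj ev-[]) ev-succ)

zeroMismatch : ℕ → ℕ → ℕ
zeroMismatch zero    zero    = 0
zeroMismatch zero    (suc _) = 1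
zeroMismatch (suc _) zero    = 1
zeroMismatch (suc _) (suc _) = 0

computable₂-zeroMismatch : Computable₂ zeroMismatch
computable₂-zeroMismatch = cases , eval
  where
  isNonzero isZero : PR 1
  isNonzero = prec zer (numeral 1)
  isZero    = prec (numeral 1) zer

  cases : PR 2
  cases = prec isNonzero (comp isZero (proj (fsuc (fsuc fzero)) ∷ []))

  eval-isNonzero : ∀ y → Eval isNonzero (y ∷ []) (zeroMismatch 0 y)
  eval-isNonzero zero    = ev-prec0 ev-zer
  eval-isNonzero (suc y) = ev-precS (eval-isNonzero y) (eval-numeral 1)

  eval-isZero : ∀ x y → Eval isZero (y ∷ []) (zeroMismatch (suc x) y)
  eval-isZero x zero    = ev-prec0 (eval-numeral 1)
  eval-isZero x (suc y) = ev-precS (eval-isZero x y) ev-zer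

  eval : ∀ x y → Eval cases (x ∷ y ∷ []) (zeroMismatch x y)
  eval zero    y = ev-prec0 (eval-isNonzero y)
  eval (suc x) y = ev-precS (eval x y) (ev-comp (ev-∷ ev-proj ev-[]) (eval-isZero x y))

CE : Rel ℕ 0ℓ → Set
CE P = Σ (PR 2) λ c → P ⇔₂ Dom c

ce-resp : P ⇔₂ Q → CE P → CE Q
ce-resp (P⇒Q , Q⇒P) (c , P⇒c , c⇒P) = c , (λ q → P⇒c (Q⇒P q)) , (λ d → P⇒Q (c⇒P d))

ce-× : CE P → CE Q → CE (λ x y → P x y × Q x y)
ce-× {P} {Q} (c , P⇒c , c⇒P) (d , Q⇒d , d⇒Q) = comp (proj fzero) (c ∷ d ∷ []) , both , split
  where
  both : ∀ {x y} → P x y × Q x y → Dom (comp (proj fzero) (c ∷ d ∷ [])) x y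
  both (p , q) with P⇒c p | Q⇒d q
  ... | z , ec | _ , ed = z , ev-comp (ev-∷ ec (ev-∷ ed ev-[])) ev-proj

  split : ∀ {x y} → Dom (comp (proj fzero) (c ∷ d ∷ [])) x y → P x y × Q x y
  split (_ , ev-comp (ev-∷ ec (ev-∷ ed ev-[])) ev-proj) = c⇒P (_ , ec) , d⇒Q (_ , ed)

ce-pullback : ∀ {f} → Computable f → CE P → CE (λ x y → P (f x) (f y))
ce-pullback {P = P} {f = f} (fc , f-eval) (c , P⇒c , c⇒P) = pullback , forward , backward
  where
  pullback : PR 2
  pullback = comp c (comp fc (proj fzero ∷ []) ∷ comp fc (proj (fsuc fzero) ∷ []) ∷ [])

  forward : ∀ {x y} → P (f x) (f y) → Dom pullback x y
  forward {x} {y} p with P⇒c p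
  ... | z , ec = z , ev-comp (ev-∷ (ev-comp (ev-∷ ev-proj ev-[]) (f-eval x))
                               (ev-∷ (ev-comp (ev-∷ ev-proj ev-[]) (f-eval y)) ev-[])) ec

  backward : ∀ {x y} → Dom pullback x y → P (f x) (f y)
  backward {x} {y} (z , ev-comp (ev-∷ (ev-comp (ev-∷ ev-proj ev-[]) ex)
                                 (ev-∷ (ev-comp (ev-∷ ev-proj ev-[]) ey) ev-[])) ec)
    with eval-deterministic ex (f-eval x) | eval-deterministic ey (f-eval y)
  ... | refl | refl = c⇒P (z , ec)

ce-zeros : ∀ {t} → Computable₂ t → CE (λ x y → t x y ≡ 0)
ce-zeros {t} (tc , t-eval) = search , halts , isZero
  where
  -- the search variable is ignored, so the search succeeds at once iff t x y ≡ 0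
  search : PR 2
  search = mu (comp tc (proj (fsuc fzero) ∷ proj (fsuc (fsuc fzero)) ∷ []))

  halts : ∀ {x y} → t x y ≡ 0 → Dom search x y
  halts {x} {y} t≡0 =
    0 , ev-mu (ev-comp (ev-∷ ev-proj (ev-∷ ev-proj ev-[])) (subst (Eval tc _) t≡0 (t-eval x y)))
              (λ _ ())

  isZero : ∀ {x y} → Dom search x y → t x y ≡ 0
  isZero {x} {y} (_ , ev-mu (ev-comp (ev-∷ ev-proj (ev-∷ ev-proj ev-[])) e) _) =
    eval-deterministic (t-eval x y) e

ceer : IsEquivalence P → CE P → Ceer
ceer eqv (c , P⇒c , c⇒P) = record
  { code  = c
  ; isEqv = record
    { refl  = P⇒c (IsEquivalence.refl eqv)
    ; sym   = λ d → P⇒c (IsEquivalence.sym eqv (c⇒P d))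
    ; trans = λ d d′ → P⇒c (IsEquivalence.trans eqv (c⇒P d) (c⇒P d′))
    }
  }

rel-ceer : (eqv : IsEquivalence P) (ce : CE P) → rel (ceer eqv ce) ⇔₂ P
rel-ceer _ (_ , P⇒c , c⇒P) = c⇒P , P⇒c

≤ᵣ-respˡ : E ⇔₂ E′ → E ≤ᵣ R → E′ ≤ᵣ R
≤ᵣ-respˡ (E⇒E′ , E′⇒E) (f , f-comp , f-red) =
  f , f-comp , λ x y → mk⇔ (to (f-red x y) ∘ E′⇒E) (E⇒E′ ∘ from (f-red x y))

≤ᵣ-respʳ : R ⇔₂ R′ → E ≤ᵣ R → E ≤ᵣ R′
≤ᵣ-respʳ (R⇒R′ , R′⇒R) (f , f-comp , f-red) =
  f , f-comp , λ x y → mk⇔ (R⇒R′ ∘ to (f-red x y)) (from (f-red x y) ∘ R′⇒R)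

infinitelyManyClasses-resp : E ⇔₂ E′ → InfinitelyManyClasses E → InfinitelyManyClasses E′
infinitelyManyClasses-resp (_ , E′⇒E) infE (xs , covers) =
  infE (xs , λ y → Any.map E′⇒E (covers y))

Id-reduction : ∀ {h} → Reflexive E → Computable h → (∀ x y → E (h x) (h y) → x ≡ y) →
               Id ≤ᵣ E
Id-reduction {h = h} reflE h-comp h-injective =
  h , h-comp , λ x y → mk⇔ (λ { refl → reflE }) (h-injective x y)

Id₁⊕ : Rel ℕ 0ℓ → Rel ℕ 0ℓ
Id₁⊕ E zero    zero    = ⊤
Id₁⊕ E (suc x) (suc y) = E x y
Id₁⊕ E _       _       = ⊥

isEquivalence-Id₁⊕ : IsEquivalence E → IsEquivalence (Id₁⊕ E)
isEquivalence-Id₁⊕ {E} eqv = record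
  { refl  = λ {x} → reflexive x
  ; sym   = λ {x} {y} → symmetric x y
  ; trans = λ {x} {y} {z} → transitive x y z
  }
  where
  module ≈ = IsEquivalence eqv

  reflexive : ∀ x → Id₁⊕ E x x
  reflexive zero    = tt
  reflexive (suc x) = ≈.refl

  symmetric : ∀ x y → Id₁⊕ E x y → Id₁⊕ E y x
  symmetric zero    zero    _ = tt
  symmetric (suc x) (suc y) e = ≈.sym e

  transitive : ∀ x y z → Id₁⊕ E x y → Id₁⊕ E y z → Id₁⊕ E x z
  transitive zero    zero    zero    _ _ = tt
  transitive (suc x) (suc y) (suc z) e e′ = ≈.trans e e′

-- The hypothesis E 0 0 is needed because at the new point 0 the second component tests
-- E (pred 0) (pred 0), and pred 0 ≡ 0.
ce-Id₁⊕ : CE E → E 0 0 → CE (Id₁⊕ E)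
ce-Id₁⊕ {E} ceE E00 =
  ce-resp (split , join) (ce-× (ce-zeros computable₂-zeroMismatch) (ce-pullback computable-pred ceE))
  where
  split : ∀ {x y} → zeroMismatch x y ≡ 0 × E (pred x) (pred y) → Id₁⊕ E x y
  split {zero}  {zero}  _       = tt
  split {suc x} {suc y} (_ , e) = e

  join : ∀ {x y} → Id₁⊕ E x y → zeroMismatch x y ≡ 0 × E (pred x) (pred y)
  join {zero}  {zero}  _ = refl , E00
  join {suc x} {suc y} e = refl , e

≤ᵣ-Id₁⊕ : E ≤ᵣ Id₁⊕ E
≤ᵣ-Id₁⊕ = suc , computable-suc , λ _ _ → ⇔-refl

Id₁⊕-infinite : InfinitelyManyClasses E → InfinitelyManyClasses (Id₁⊕ E)
Id₁⊕-infinite {E} infE (xs , covers) =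
  infE (map pred xs , λ y → gmap {f = pred} (λ {x} → unshift y {x}) (covers (suc y)))
  where
  unshift : ∀ y {x} → Id₁⊕ E (suc y) x → E y (pred x)
  unshift y {suc x} e = e

-- A reduction f of Id may send at most one point to the new class 0, so for each n one
-- of f (1 + n) and f 0 is a successor, and its predecessor represents n in E.
Id≤Id₁⊕⇒Id≤ : Reflexive E → Id ≤ᵣ Id₁⊕ E → Id ≤ᵣ E
Id≤Id₁⊕⇒Id≤ {E} reflE (f , f-comp , f-red) = Id-reduction {E = E} reflE h-comp h-injective
  where
  h : ℕ → ℕ
  h n = pred (firstNonzero (f (suc n)) (f 0))

  h-comp : Computable h
  h-comp = computable-∘ {g = λ n → firstNonzero (f (suc n)) (f 0)} computable-pred
             (computable₂-∘ {f = f ∘ suc} {g = λ _ → f 0} computable₂-firstNonzero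
               (computable-∘ f-comp computable-suc) (computable-∘ f-comp (computable-const 0)))

  f-injective : ∀ {x y} → Id₁⊕ E (f x) (f y) → x ≡ y
  f-injective {x} {y} = from (f-red x y)

  atMostOneZero : ∀ x y → f x ≡ 0 → f y ≡ 0 → x ≡ y
  atMostOneZero _ _ fx≡0 fy≡0 = f-injective (subst₂ (Id₁⊕ E) (sym fx≡0) (sym fy≡0) tt)

  Source : ℕ → ℕ → Set
  Source n i = i ≡ suc n ⊎ (i ≡ 0 × f (suc n) ≡ 0)

  source : ∀ n → Σ ℕ λ i → f i ≡ suc (h n) × Source n i
  source n with f (suc n) in f1+n≡
  ... | suc _ = suc n , f1+n≡ , inj₁ refl
  ... | zero with f 0 in f0≡
  ...   | suc _ = 0 , f0≡ , inj₂ (refl , refl)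
  ...   | zero  = ⊥-elim (0≢1+n (atMostOneZero 0 (suc n) f0≡ f1+n≡))

  source-injective : ∀ {n m i} → Source n i → Source m i → n ≡ m
  source-injective (inj₁ refl)       (inj₁ refl)       = refl
  source-injective (inj₂ (refl , p)) (inj₂ (_ , q))    = suc-injective (atMostOneZero _ _ p q)
  source-injective (inj₁ refl)       (inj₂ (() , _))
  source-injective (inj₂ (refl , _)) (inj₁ ())

  h-injective : ∀ n m → E (h n) (h m) → n ≡ m
  h-injective n m e with source n | source m
  ... | i , fi≡ , src-i | j , fj≡ , src-j
    with f-injective (subst₂ (Id₁⊕ E) (sym fi≡) (sym fj≡) e)
  ... | refl = source-injective src-i src-j

Id₁⊕≤⇒Id≤ : Reflexive E → Id₁⊕ E ≤ᵣ E → Id ≤ᵣ E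
Id₁⊕≤⇒Id≤ {E} reflE (g , g-comp , g-red) = Id-reduction {E = E} reflE h-comp h-injective
  where
  h : ℕ → ℕ
  h = fold (g 0) (g ∘ suc)

  h-comp : Computable h
  h-comp = computable-fold (g 0) (computable-∘ g-comp computable-suc)

  g-reflects : ∀ x y → E (g x) (g y) → Id₁⊕ E x y
  g-reflects x y = from (g-red x y)

  h-injective : ∀ n m → E (h n) (h m) → n ≡ m
  h-injective zero    zero    _ = refl
  h-injective zero    (suc m) e = ⊥-elim (g-reflects 0 (suc (h m)) e)
  h-injective (suc n) zero    e = ⊥-elim (g-reflects (suc (h n)) 0 e)
  h-injective (suc n) (suc m) e =
    cong suc (h-injective n m (g-reflects (suc (h n)) (suc (h m)) e))

module _ (E : Ceer) where
  private
    isEquivalence : IsEquivalence (Id₁⊕ (rel E))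
    isEquivalence = isEquivalence-Id₁⊕ (isEqv E)

    ce : CE (Id₁⊕ (rel E))
    ce = ce-Id₁⊕ (code E , id , id) (IsEquivalence.refl (isEqv E))

  Id₁⊕ᶜ : Ceer
  Id₁⊕ᶜ = ceer isEquivalence ce

  rel-Id₁⊕ᶜ : rel Id₁⊕ᶜ ⇔₂ Id₁⊕ (rel E)
  rel-Id₁⊕ᶜ = rel-ceer isEquivalence ce

Id₁⊕ᶜ-dark : (E : Ceer) → Dark E → Dark (Id₁⊕ᶜ E)
Id₁⊕ᶜ-dark E (infE , Id≰E) =
  infinitelyManyClasses-resp (swap (rel-Id₁⊕ᶜ E)) (Id₁⊕-infinite infE) ,
  Id≰E ∘ Id≤Id₁⊕⇒Id≤ (IsEquivalence.refl (isEqv E))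
       ∘ ≤ᵣ-respʳ {E = Id} (rel-Id₁⊕ᶜ E)

corollary3p8 : ¬ (Σ Ceer λ E → Dark E × (∀ (R : Ceer) → Dark R → rel E ≤ᵣ rel R → rel R ≤ᵣ rel E))
corollary3p8 (E , darkE@(_ , Id≰E) , maximal) =
  Id≰E (Id₁⊕≤⇒Id≤ (IsEquivalence.refl (isEqv E)) Id₁⊕E≤E)
  where
  E≤Id₁⊕E : rel E ≤ᵣ rel (Id₁⊕ᶜ E)
  E≤Id₁⊕E = ≤ᵣ-respʳ {E = rel E} (swap (rel-Id₁⊕ᶜ E)) ≤ᵣ-Id₁⊕

  Id₁⊕E≤E : Id₁⊕ (rel E) ≤ᵣ rel E
  Id₁⊕E≤E = ≤ᵣ-respˡ {R = rel E} (rel-Id₁⊕ᶜ E) (maximal (Id₁⊕ᶜ E) (Id₁⊕ᶜ-dark E darkE) E≤Id₁⊕E)
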